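{- Let $\Gamma=(V,E)$ be a finite connected regular graph, $G\le\mathrm{Aut}\,\Gamma$ transitive on $V$, $N\ne 1$ a normal subgroup of $G$, and $\Delta$ a union of some $G$-orbits on the arc set of $\Gamma$, regarded as a digraph on $V$, and assume $\Delta$ is connected. Let $\alpha\in V$ and $\beta\in\Delta(\alpha)$. Then $\pi(N_\alpha)=\pi(N_\alpha^{\Delta(\alpha)})$ and $|\Delta(\alpha)|\ge\max\pi(N_\alpha)$. If further $\Delta=\Delta^*$, then $|\Delta(\alpha)|>\max\pi(N_{\alpha\beta})$.
   Context: Arcs of $\Gamma$ are ordered pairs $(\alpha,\beta)$ with $\{\alpha,\beta\}\in E$. $\Delta(\alpha)=\{\beta\in V\mid(\alpha,\beta)\in\Delta\}$; $\Delta^*=\{(\alpha,\beta)\mid(\beta,\alpha)\in\Delta\}$. $N_\alpha$ is the stabilizer of $\alpha$ in $N$, $N_{\alpha\beta}=N_\alpha\cap N_\beta$, and $N_\alpha^{\Delta(\alpha)}$ is the permutation group induced by $N_\alpha$ on $\Delta(\alpha)$. For a finite group $Y$, $\pi(Y)$ is the set of prime divisors of $|Y|$. -}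

module Defs where

open import Data.Nat using (ℕ; _≤_; _<_)
open import Data.Nat.Divisibility using (_∣_)
open import Data.Nat.Primality using (Prime)
open import Data.Bool using (Bool; T; _∨_; _∧_; not)
open import Data.Fin using (Fin; _≟_)
open import Data.Vec using (Vec; lookup; tabulate; allFin)
import Data.Vec.Properties as VecP
import Data.List.Properties as ListP
open import Data.List using (List; length; filterᵇ; deduplicate; map)
import Data.List as L
open import Data.List.Membership.Propositional using (_∈_)
open import Data.List.Relation.Unary.Unique.Propositional using (Unique)
open import Data.Product using (Σ; ∃; _×_; _,_)
open import Relation.Binary.PropositionalEquality using (_≡_; _≢_)
open import Relation.Nullary.Decidable using (⌊_⌋; Dec)
open import Function.Bundles using (_⇔_)

-- Vertex set V = Fin n.  A (simple undirected) graph is a Boolean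
-- adjacency relation; a digraph is a Boolean arc relation.
Rel𝔹 : ℕ → Set
Rel𝔹 n = Fin n → Fin n → Bool

IsSimpleGraph : ∀ {n} → Rel𝔹 n → Set
IsSimpleGraph {n} adj = (∀ (u v : Fin n) → adj u v ≡ adj v u) × (∀ (u : Fin n) → adj u u ≡ Bool.false)
  where import Data.Bool as Bool

data Reachable {n} (R : Rel𝔹 n) : Fin n → Fin n → Set where
  here : ∀ {u} → Reachable R u u
  step : ∀ {u v w} → T (R u v) → Reachable R v w → Reachable R u w

Connected : ∀ {n} → Rel𝔹 n → Set
Connected {n} R = ∀ (u v : Fin n) → Reachable R u v

nbhd : ∀ {n} → Rel𝔹 n → Fin n → List (Fin n)
nbhd {n} R α = filterᵇ (R α) (Data.Vec.toList (allFin n))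
  where import Data.Vec

deg : ∀ {n} → Rel𝔹 n → Fin n → ℕ
deg R α = length (nbhd R α)

Regular : ∀ {n} → Rel𝔹 n → Set
Regular {n} adj = ∃ λ k → ∀ (v : Fin n) → deg adj v ≡ k

-- underlying undirected relation of a digraph (for connectivity of Δ)
sym𝔹 : ∀ {n} → Rel𝔹 n → Rel𝔹 n
sym𝔹 R u v = R u v ∨ R v u

conv : ∀ {n} → Rel𝔹 n → Rel𝔹 n
conv R u v = R v u

Perm : ℕ → Set
Perm n = Vec (Fin n) n

app : ∀ {n} → Perm n → Fin n → Fin n
app = lookup

IsPerm : ∀ {n} → Perm n → Set
IsPerm {n} g = ∀ (i j : Fin n) → app g i ≡ app g j → i ≡ j

idP : ∀ {n} → Perm n
idP {n} = allFin n

_∘P_ : ∀ {n} → Perm n → Perm n → Perm n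
g ∘P h = tabulate λ i → app g (app h i)

_≟P_ : ∀ {n} (g h : Perm n) → Dec (g ≡ h)
_≟P_ = VecP.≡-dec _≟_


-- A finite permutation group on Fin n, given by the (duplicate-free) list
-- of its elements: contains 1, closed under products, all elements are
-- permutations (finite + closed under products gives closure under inverses).
record PermGroup (n : ℕ) : Set where
  field
    elems   : List (Perm n)
    unique  : Unique elems
    perms   : ∀ {g} → g ∈ elems → IsPerm g
    hasId   : idP ∈ elems
    closed  : ∀ {g h} → g ∈ elems → h ∈ elems → (g ∘P h) ∈ elems
open PermGroup public

order : ∀ {n} → PermGroup n → ℕ
order G = length (elems G)

-- subgroup and normal subgroup (gN ⊆ Ng for all g ∈ G, i.e. gNg⁻¹ ⊆ N)
_≤G_ : ∀ {n} → PermGroup n → PermGroup n → Set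
N ≤G G = ∀ {h} → h ∈ elems N → h ∈ elems G

_⊴_ : ∀ {n} → PermGroup n → PermGroup n → Set
N ⊴ G = (N ≤G G) ×
  (∀ {g h} → g ∈ elems G → h ∈ elems N → ∃ λ h′ → h′ ∈ elems N × (g ∘P h) ≡ (h′ ∘P g))

Nontrivial : ∀ {n} → PermGroup n → Set
Nontrivial N = ∃ λ h → h ∈ elems N × h ≢ idP

AutGroup : ∀ {n} → Rel𝔹 n → PermGroup n → Set
AutGroup {n} adj G = ∀ {g} → g ∈ elems G → ∀ (u v : Fin n) → adj (app g u) (app g v) ≡ adj u v

VertexTransitive : ∀ {n} → PermGroup n → Set
VertexTransitive {n} G = ∀ (u v : Fin n) → ∃ λ g → g ∈ elems G × app g u ≡ v

-- Δ is a union of G-orbits on the arc set of Γ: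
-- a G-invariant set of arcs of Γ.
UnionOfArcOrbits : ∀ {n} → Rel𝔹 n → PermGroup n → Rel𝔹 n → Set
UnionOfArcOrbits {n} adj G Δ =
  (∀ (u v : Fin n) → T (Δ u v) → T (adj u v)) ×
  (∀ {g} → g ∈ elems G → ∀ (u v : Fin n) → Δ (app g u) (app g v) ≡ Δ u v)

stabList : ∀ {n} → List (Perm n) → Fin n → List (Perm n)
stabList xs α = filterᵇ (λ g → ⌊ app g α ≟ α ⌋) xs

ordStab : ∀ {n} → PermGroup n → Fin n → ℕ
ordStab N α = length (stabList (elems N) α)

ordStab2 : ∀ {n} → PermGroup n → Fin n → Fin n → ℕ
ordStab2 N α β = length (stabList (stabList (elems N) α) β)

-- |N_α^{Δ(α)}|: the number of distinct permutations of Δ(α) induced by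
-- elements of N_α (each recorded as its list of images of Δ(α)).
ordInduced : ∀ {n} → PermGroup n → Rel𝔹 n → Fin n → ℕ
ordInduced {n} N Δ α =
  length (deduplicate (ListP.≡-dec _≟_)
           (map (λ g → map (app g) (nbhd Δ α)) (stabList (elems N) α)))

SamePrimeDivisors : ℕ → ℕ → Set
SamePrimeDivisors a b = ∀ p → Prime p → (p ∣ a ⇔ p ∣ b)

-- "max π(Y) ≤ d" (vacuous when π(Y) = ∅)
MaxPrimeDiv≤ : ℕ → ℕ → Set
MaxPrimeDiv≤ a d = ∀ p → Prime p → p ∣ a → p ≤ d

MaxPrimeDiv< : ℕ → ℕ → Set
MaxPrimeDiv< a d = ∀ p → Prime p → p ∣ a → p < d

module Submission where

-- All three claims come
-- from one descent.  Starting from S = [α] (or [β, α]), repeatedly pick an arc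
-- γ → δ with γ ∈ S, δ ∉ S (one exists because Δ is strongly connected, being
-- connected and vertex-transitive) and enlarge S to some S′ ∋ δ.  By the
-- orbit–stabiliser theorem |N_S| = index · |N_S′|, so a prime p dividing |N_S|
-- divides the index or |N_S′|; as N_V = 1, it eventually divides an index.
--   (1) Enlarging S by all of Δ(γ), the index is the length of an N_S-orbit of
--       reorderings of Δ(γ); it divides |N_γ^{Δ(γ)}| = |N_α^{Δ(α)}|.
--   (2) Enlarging S by δ, the index is |δ^{N_S}| ≤ |Δ(γ)| = |Δ(α)|.
--   (3) If Δ = Δ*, γ also has an out-neighbour μ ∈ S, which N_S fixes, so
--       |δ^{N_S}| < |Δ(α)|.

open import Defs
open import Data.Nat using (ℕ; zero; suc; _+_; _*_; _≤_; _<_; s≤s; z≤n; >-nonZero)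
open import Data.Nat.Properties
open import Data.Nat.Divisibility using (_∣_; ∣-refl; _∣0; ∣m∣n⇒∣m+n; ∣1⇒≡1; ∣⇒≤; ∣m⇒∣m*n; ∣-trans)
open import Data.Nat.Primality using (Prime; ¬prime[1]; euclidsLemma)
open import Data.Nat.Induction using (<-wellFounded)
open import Induction.WellFounded using (Acc; acc)
open import Data.Fin using (Fin; toℕ) renaming (_≟_ to _≟F_)
import Data.Fin.Properties as FinP
open import Data.Bool using (T)
open import Data.Bool.Properties using (T-∨)
open import Data.Sum using (inj₁; inj₂)
open import Function.Bundles using (Equivalence)
open import Data.Vec using (allFin)
import Data.Vec as Vec
import Data.Vec.Properties as VecP
open import Data.List using (List; []; _∷_; _++_; length; filter; filterᵇ; map; deduplicate)
open import Data.List.Properties using (filter-notAll; length-map)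
import Data.List as List
import Data.List.Properties as ListP
open import Data.List.Membership.Propositional using (_∈_; _∉_)
open import Data.List.Membership.Propositional.Properties
  using (∈-filter⁺; ∈-filter⁻; ∈-map⁺; ∈-map⁻; ∈-deduplicate⁺; ∈-deduplicate⁻; ∈-length; ∈-allFin; ∈-++⁺ˡ; ∈-++⁺ʳ)
open import Data.List.Relation.Binary.Subset.Propositional using (_⊆_)
open import Data.List.Relation.Unary.Any using (here; there)
import Data.List.Relation.Unary.Any as Any
open import Data.List.Relation.Unary.All using (All; []; _∷_)
import Data.List.Relation.Unary.All as All
open import Data.List.Relation.Unary.All.Properties using (¬Any⇒All¬; ¬All⇒Any¬)
import Data.List.Relation.Unary.All.Properties as AllP
open import Data.List.Relation.Unary.Unique.Propositional using (Unique; _∷_)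
open import Data.List.Relation.Unary.Unique.Propositional.Properties using (map⁺; filter⁺; allFin⁺)
open import Data.List.Relation.Unary.Unique.DecPropositional.Properties using (deduplicate-!)
open import Data.Product using (∃; _×_; _,_; proj₁; proj₂)
open import Data.Empty using (⊥-elim)
open import Data.Unit using (⊤; tt)
open import Function.Bundles using (mk⇔)
open import Function using (_∘_; id)
open import Relation.Nullary using (yes; no; ¬?)
open import Relation.Nullary.Decidable using (⌊_⌋; toWitness; fromWitness; T?)
open import Relation.Unary using (Decidable)
open import Relation.Unary.Properties using (∁?)
open import Relation.Binary.Definitions using (DecidableEquality)
open import Relation.Binary.PropositionalEquality
  using (_≡_; _≢_; refl; sym; trans; cong; cong₂; subst; subst₂; module ≡-Reasoning)

length-filter-∁ : ∀ {A : Set} {P : A → Set} (P? : Decidable P) xs →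
                  length xs ≡ length (filter P? xs) + length (filter (∁? P?) xs)
length-filter-∁ P? [] = refl
length-filter-∁ P? (x ∷ xs) with P? x
... | yes _ = cong suc (length-filter-∁ P? xs)
... | no  _ = trans (cong suc (length-filter-∁ P? xs)) (sym (+-suc _ _))

module Counting {A : Set} (_≟_ : DecidableEquality A) where

  remove : A → List A → List A
  remove x = filter (λ y → ¬? (x ≟ y))

  remove-shorter : ∀ {x ys} → x ∈ ys → length (remove x ys) < length ys
  remove-shorter {x} {ys} x∈ys = filter-notAll (λ y → ¬? (x ≟ y)) ys (Any.map (λ x≡y x≢y → x≢y x≡y) x∈ys)

  ⊆⇒length≤ : ∀ {xs ys} → Unique xs → xs ⊆ ys → length xs ≤ length ys
  ⊆⇒length≤ {[]}     _            _     = z≤n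
  ⊆⇒length≤ {x ∷ xs} {ys} (x∉xs ∷ u) xs⊆ys =
    ≤-trans (s≤s (⊆⇒length≤ u xs⊆rest)) (remove-shorter (xs⊆ys (here refl)))
    where
    xs⊆rest : xs ⊆ remove x ys
    xs⊆rest z∈xs = ∈-filter⁺ (λ y → ¬? (x ≟ y)) (xs⊆ys (there z∈xs)) (All.lookup x∉xs z∈xs)

  ⊆-missing⇒length< : ∀ {xs ys y} → Unique xs → xs ⊆ ys → y ∈ ys → y ∉ xs → length xs < length ys
  ⊆-missing⇒length< {xs} {ys} {y} u xs⊆ys y∈ys y∉xs = ⊆⇒length≤ (¬Any⇒All¬ xs y∉xs ∷ u) y∷xs⊆ys
    where
    y∷xs⊆ys : (y ∷ xs) ⊆ ys
    y∷xs⊆ys (here refl)  = y∈ys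
    y∷xs⊆ys (there z∈xs) = xs⊆ys z∈xs

  ⊆⊇⇒length≡ : ∀ {xs ys} → Unique xs → Unique ys → xs ⊆ ys → ys ⊆ xs → length xs ≡ length ys
  ⊆⊇⇒length≡ u v xs⊆ys ys⊆xs = ≤-antisym (⊆⇒length≤ u xs⊆ys) (⊆⇒length≤ v ys⊆xs)

  injection⇒length≤ : ∀ {B : Set} {f : B → A} {xs : List B} {ys} → (∀ {a b} → f a ≡ f b → a ≡ b) →
                      Unique xs → (∀ {x} → x ∈ xs → f x ∈ ys) → length xs ≤ length ys
  injection⇒length≤ {f = f} {xs} {ys} f-inj u maps-into =
    subst (_≤ length ys) (length-map f xs) (⊆⇒length≤ (map⁺ f-inj u) image⊆ys)
    where
    image⊆ys : map f xs ⊆ ys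
    image⊆ys y∈image with x , x∈xs , refl ← ∈-map⁻ f y∈image = maps-into x∈xs

  module Fibres {B : Set} (f : B → A) where

    fibre : A → List B → List B
    fibre y = filter (λ x → f x ≟ y)

    fibre-after-removal : ∀ {y y′} → y′ ≢ y → ∀ xs → fibre y′ (filter (λ x → ¬? (f x ≟ y)) xs) ≡ fibre y′ xs
    fibre-after-removal y′≢y [] = refl
    fibre-after-removal {y} {y′} y′≢y (x ∷ xs) with f x ≟ y
    ... | yes fx≡y with f x ≟ y′
    ...   | yes fx≡y′ = ⊥-elim (y′≢y (trans (sym fx≡y′) fx≡y))
    ...   | no  _     = fibre-after-removal y′≢y xs
    fibre-after-removal {y} {y′} y′≢y (x ∷ xs) | no _ with f x ≟ y′
    ...   | yes _ = cong (x ∷_) (fibre-after-removal y′≢y xs)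
    ...   | no  _ = fibre-after-removal y′≢y xs

    count-by-fibres : ∀ m ys xs → Unique ys → (∀ {x} → x ∈ xs → f x ∈ ys) →
                      (∀ {y} → y ∈ ys → length (fibre y xs) ≡ m) → length xs ≡ length ys * m
    count-by-fibres m []       []      _ _ _ = refl
    count-by-fibres m []       (x ∷ _) _ maps-into _ with () ← maps-into (here refl)
    count-by-fibres m (y ∷ ys) xs (y∉ys ∷ u) maps-into fibre-size =
      trans (length-filter-∁ (λ x → f x ≟ y) xs)
            (cong₂ _+_ (fibre-size (here refl)) (count-by-fibres m ys rest u rest-into rest-fibres))
      where
      rest = filter (λ x → ¬? (f x ≟ y)) xs
      rest-into : ∀ {x} → x ∈ rest → f x ∈ ys
      rest-into x∈rest with x∈xs , fx≢y ← ∈-filter⁻ (λ x → ¬? (f x ≟ y)) x∈rest with maps-into x∈xs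
      ... | here fx≡y   = ⊥-elim (fx≢y fx≡y)
      ... | there fx∈ys = fx∈ys
      rest-fibres : ∀ {y′} → y′ ∈ ys → length (fibre y′ rest) ≡ m
      rest-fibres y′∈ys = trans (cong length (fibre-after-removal (λ y′≡y → All.lookup y∉ys y′∈ys (sym y′≡y)) xs))
                                (fibre-size (there y′∈ys))

module _ {n : ℕ} where

  app-∘ : ∀ (g h : Perm n) i → app (g ∘P h) i ≡ app g (app h i)
  app-∘ g h i = VecP.lookup∘tabulate _ i

  app-id : ∀ i → app (idP {n}) i ≡ i
  app-id = VecP.lookup-allFin

  perm-ext : ∀ {g h : Perm n} → (∀ i → app g i ≡ app h i) → g ≡ h
  perm-ext {g} {h} g≗h =
    trans (sym (VecP.tabulate∘lookup g)) (trans (VecP.tabulate-cong g≗h) (VecP.tabulate∘lookup h))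

  ∘-assoc : ∀ (f g h : Perm n) → (f ∘P g) ∘P h ≡ f ∘P (g ∘P h)
  ∘-assoc f g h = perm-ext λ i → begin
    app ((f ∘P g) ∘P h) i    ≡⟨ app-∘ (f ∘P g) h i ⟩
    app (f ∘P g) (app h i)   ≡⟨ app-∘ f g _ ⟩
    app f (app g (app h i))  ≡⟨ cong (app f) (app-∘ g h i) ⟨
    app f (app (g ∘P h) i)   ≡⟨ app-∘ f (g ∘P h) i ⟨
    app (f ∘P (g ∘P h)) i    ∎
    where open ≡-Reasoning

  ∘-identityˡ : ∀ (g : Perm n) → idP ∘P g ≡ g
  ∘-identityˡ g = perm-ext λ i → trans (app-∘ idP g i) (app-id _)

  ∘-identityʳ : ∀ (g : Perm n) → g ∘P idP ≡ g
  ∘-identityʳ g = perm-ext λ i → trans (app-∘ g idP i) (cong (app g) (app-id i))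

  ∘-cancelˡ : ∀ g {h h′} → IsPerm g → g ∘P h ≡ g ∘P h′ → h ≡ h′
  ∘-cancelˡ g {h} {h′} g-inj gh≡gh′ = perm-ext λ i →
    g-inj _ _ (trans (sym (app-∘ g h i)) (trans (cong (λ k → app k i) gh≡gh′) (app-∘ g h′ i)))

record Inverse {n} (H : PermGroup n) (g : Perm n) : Set where
  field
    g⁻¹   : Perm n
    g⁻¹∈H : g⁻¹ ∈ elems H
    invʳ  : g ∘P g⁻¹ ≡ idP
    invˡ  : g⁻¹ ∘P g ≡ idP

  app-invˡ : ∀ x → app g⁻¹ (app g x) ≡ x
  app-invˡ x = trans (sym (app-∘ g⁻¹ g x)) (trans (cong (λ k → app k x) invˡ) (app-id x))

  app-invʳ : ∀ x → app g (app g⁻¹ x) ≡ x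
  app-invʳ x = trans (sym (app-∘ g g⁻¹ x)) (trans (cong (λ k → app k x) invʳ) (app-id x))

-- A finite set of permutations closed under products is closed under
-- inverses: left multiplication by g is injective on H, hence onto, so it hits idP.
inverse : ∀ {n} (H : PermGroup n) {g} → g ∈ elems H → Inverse H g
inverse {n} H {g} g∈H with idP ∈? map (g ∘P_) (elems H)
  where open import Data.List.Membership.DecPropositional (_≟P_ {n}) using (_∈?_)
... | no id∉gH = ⊥-elim (<-irrefl (length-map (g ∘P_) (elems H))
                   (⊆-missing⇒length< (map⁺ (∘-cancelˡ g g-inj) (unique H)) gH⊆H (hasId H) id∉gH))
  where
  open Counting _≟P_ using (⊆-missing⇒length<)
  g-inj = perms H g∈H
  gH⊆H : map (g ∘P_) (elems H) ⊆ elems H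
  gH⊆H y∈gH with h , h∈H , refl ← ∈-map⁻ (g ∘P_) y∈gH = closed H g∈H h∈H
... | yes id∈gH with g′ , g′∈H , id≡gg′ ← ∈-map⁻ (g ∘P_) id∈gH = record
  { g⁻¹ = g′ ; g⁻¹∈H = g′∈H ; invʳ = sym id≡gg′
  ; invˡ = ∘-cancelˡ g (perms H g∈H) g[g′g]≡g[id] }
  where
  open ≡-Reasoning
  g[g′g]≡g[id] : g ∘P (g′ ∘P g) ≡ g ∘P idP
  g[g′g]≡g[id] = begin
    g ∘P (g′ ∘P g)  ≡⟨ ∘-assoc g g′ g ⟨
    (g ∘P g′) ∘P g  ≡⟨ cong (_∘P g) id≡gg′ ⟨
    idP ∘P g        ≡⟨ ∘-identityˡ g ⟩
    g               ≡⟨ ∘-identityʳ g ⟨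
    g ∘P idP        ∎

module Action {n} {X : Set} (_≟X_ : DecidableEquality X) (act : Perm n → X → X)
  (act-∘ : ∀ g h x → act (g ∘P h) x ≡ act g (act h x)) (act-id : ∀ x → act idP x ≡ x)
  (H : PermGroup n) where

  open Counting _≟X_ using (⊆⊇⇒length≡; module Fibres)
  private module CountPerms = Counting (_≟P_ {n})

  orbit : X → List X
  orbit x = deduplicate _≟X_ (map (λ a → act a x) (elems H))

  stab : X → List (Perm n)
  stab x = filterᵇ (λ a → ⌊ act a x ≟X x ⌋) (elems H)

  ∈stab⁻ : ∀ {a x} → a ∈ stab x → a ∈ elems H × act a x ≡ x
  ∈stab⁻ {a} {x} a∈stab with a∈H , fixes ← ∈-filter⁻ (λ a → T? ⌊ act a x ≟X x ⌋) a∈stab = a∈H , toWitness fixes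

  ∈stab⁺ : ∀ {a x} → a ∈ elems H → act a x ≡ x → a ∈ stab x
  ∈stab⁺ {a} {x} a∈H fixes = ∈-filter⁺ (λ a → T? ⌊ act a x ≟X x ⌋) a∈H (fromWitness fixes)

  ∈orbit⁻ : ∀ {y x} → y ∈ orbit x → ∃ λ a → a ∈ elems H × y ≡ act a x
  ∈orbit⁻ {y} {x} y∈orbit = ∈-map⁻ (λ a → act a x) (∈-deduplicate⁻ _≟X_ _ y∈orbit)

  ∈orbit⁺ : ∀ {a x} → a ∈ elems H → act a x ∈ orbit x
  ∈orbit⁺ {a} {x} a∈H = ∈-deduplicate⁺ _≟X_ (∈-map⁺ (λ a → act a x) a∈H)

  orbit-unique : ∀ x → Unique (orbit x)
  orbit-unique x = deduplicate-! _≟X_ _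

  stab-unique : ∀ x → Unique (stab x)
  stab-unique x = filter⁺ _ (unique H)

  x∈orbit : ∀ x → x ∈ orbit x
  x∈orbit x = subst (_∈ orbit x) (act-id x) (∈orbit⁺ (hasId H))

  idP∈stab : ∀ x → idP ∈ stab x
  idP∈stab x = ∈stab⁺ (hasId H) (act-id x)

  act-invˡ : ∀ {a} (a⁻¹ : Inverse H a) x → act (Inverse.g⁻¹ a⁻¹) (act a x) ≡ x
  act-invˡ {a} a⁻¹ x =
    trans (sym (act-∘ (Inverse.g⁻¹ a⁻¹) a x)) (trans (cong (λ k → act k x) (Inverse.invˡ a⁻¹)) (act-id x))

  -- Orbit–stabiliser theorem: |H| = |x^H| · |H_x|.  The fibre of a ↦ a x over
  -- y = h x is the coset h H_x, whose size is |H_x|.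
  orbit-stabiliser : ∀ x → length (elems H) ≡ length (orbit x) * length (stab x)
  orbit-stabiliser x =
    count-by-fibres (length (stab x)) (orbit x) (elems H) (orbit-unique x) ∈orbit⁺ fibre-size
    where
    open Fibres (λ a → act a x)
    fibre-size : ∀ {y} → y ∈ orbit x → length (fibre y (elems H)) ≡ length (stab x)
    fibre-size {y} y∈orbit with h , h∈H , y≡hx ← ∈orbit⁻ y∈orbit = ≤-antisym fibre≤stab stab≤fibre
      where
      open Inverse (inverse H h∈H)
      ∈fibre⁻ : ∀ {a} → a ∈ fibre y (elems H) → a ∈ elems H × act a x ≡ y
      ∈fibre⁻ = ∈-filter⁻ (λ a → act a x ≟X y)
      fibre≤stab : length (fibre y (elems H)) ≤ length (stab x)
      fibre≤stab = CountPerms.injection⇒length≤ (∘-cancelˡ g⁻¹ (perms H g⁻¹∈H)) (filter⁺ _ (unique H))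
        λ {a} a∈fibre → let (a∈H , ax≡y) = ∈fibre⁻ a∈fibre in
          ∈stab⁺ (closed H g⁻¹∈H a∈H)
            (trans (act-∘ g⁻¹ a x) (trans (cong (act g⁻¹) (trans ax≡y y≡hx)) (act-invˡ (inverse H h∈H) x)))
      stab≤fibre : length (stab x) ≤ length (fibre y (elems H))
      stab≤fibre = CountPerms.injection⇒length≤ (∘-cancelˡ h (perms H h∈H)) (stab-unique x)
        λ {a} a∈stab → let (a∈H , ax≡x) = ∈stab⁻ a∈stab in
          ∈-filter⁺ (λ a → act a x ≟X y) (closed H h∈H a∈H)
            (trans (act-∘ h a x) (trans (cong (act h) ax≡x) (sym y≡hx)))

  orbit-backwards : ∀ {a x y} → a ∈ elems H → act a x ∈ orbit y → x ∈ orbit y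
  orbit-backwards {a} {x} {y} a∈H ax∈orbit with b , b∈H , ax≡by ← ∈orbit⁻ ax∈orbit =
    subst (_∈ orbit y) x≡a⁻¹by (∈orbit⁺ (closed H g⁻¹∈H b∈H))
    where
    open Inverse (inverse H a∈H)
    x≡a⁻¹by : act (g⁻¹ ∘P b) y ≡ x
    x≡a⁻¹by = trans (act-∘ g⁻¹ b y) (trans (cong (act g⁻¹) (sym ax≡by)) (act-invˡ (inverse H a∈H) x))

  -- An H-invariant duplicate-free list all of whose orbits have m elements has
  -- length divisible by m: it is the disjoint union of these orbits.
  equal-orbits⇒∣ : ∀ m Xs → Unique Xs → (∀ {a x} → a ∈ elems H → x ∈ Xs → act a x ∈ Xs) →
                   (∀ {x} → x ∈ Xs → length (orbit x) ≡ m) → m ∣ length Xs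
  equal-orbits⇒∣ m Xs = go Xs (<-wellFounded (length Xs))
    where
    open import Data.List.Membership.DecPropositional _≟X_ using (_∈?_)
    go : ∀ Xs → Acc _<_ (length Xs) → Unique Xs → (∀ {a x} → a ∈ elems H → x ∈ Xs → act a x ∈ Xs) →
         (∀ {x} → x ∈ Xs → length (orbit x) ≡ m) → m ∣ length Xs
    go []        _          _ _         _           = m ∣0
    go Xs@(x₀ ∷ _) (acc smaller) u invariant orbit-size =
      subst (m ∣_) (sym Xs-split) (∣m∣n⇒∣m+n ∣-refl
        (go rest (smaller rest-shorter) (filter⁺ (∁? in-O?) u) rest-invariant (orbit-size ∘ rest⊆Xs)))
      where
      O = orbit x₀
      in-O? = λ x → x ∈? O
      rest = filter (∁? in-O?) Xs
      rest⊆Xs : rest ⊆ Xs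
      rest⊆Xs x∈rest = proj₁ (∈-filter⁻ (∁? in-O?) x∈rest)
      O-part : length (filter in-O? Xs) ≡ m
      O-part = trans (⊆⊇⇒length≡ (filter⁺ in-O? u) (orbit-unique x₀) (λ x∈ → proj₂ (∈-filter⁻ in-O? x∈)) O⊆Xs)
                     (orbit-size (here refl))
        where
        O⊆Xs : O ⊆ filter in-O? Xs
        O⊆Xs x∈O with a , a∈H , refl ← ∈orbit⁻ x∈O = ∈-filter⁺ in-O? (invariant a∈H (here refl)) x∈O
      Xs-split : length Xs ≡ m + length rest
      Xs-split = trans (length-filter-∁ in-O? Xs) (cong (_+ length rest) O-part)
      rest-shorter : length rest < length Xs
      rest-shorter = filter-notAll (∁? in-O?) Xs (here (λ x₀∉O → x₀∉O (x∈orbit x₀)))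
      rest-invariant : ∀ {a x} → a ∈ elems H → x ∈ rest → act a x ∈ rest
      rest-invariant a∈H x∈rest with x∈Xs , x∉O ← ∈-filter⁻ (∁? in-O?) x∈rest =
        ∈-filter⁺ (∁? in-O?) (invariant a∈H x∈Xs) (λ ax∈O → x∉O (orbit-backwards a∈H ax∈O))

_◅◅_ : ∀ {n} {R : Rel𝔹 n} {u v w} → Reachable R u v → Reachable R v w → Reachable R u w
here       ◅◅ q = q
step uv p ◅◅ q = step uv (p ◅◅ q)

module _ {n} {R : Rel𝔹 n} where
  open import Data.List.Membership.DecPropositional (_≟F_ {n}) using (_∈?_)

  leaving-arc : ∀ (S : List (Fin n)) {u v} → Reachable R u v → u ∈ S → v ∉ S →
                ∃ λ γ → ∃ λ δ → γ ∈ S × δ ∉ S × T (R γ δ)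
  leaving-arc S here u∈S v∉S = ⊥-elim (v∉S u∈S)
  leaving-arc S {u} (step {v = w} uw walk) u∈S v∉S with w ∈? S
  ... | yes w∈S = leaving-arc S walk w∈S v∉S
  ... | no  w∉S = u , w , u∈S , w∉S , uw

-- An arc u → g u lies on the closed walk
-- u → g u → g² u → ⋯ → gᵏ u = u, so every arc can be traversed backwards.
module StrongConnectivity {n} (G : PermGroup n) (Δ : Rel𝔹 n)
  (Δ-invariant : ∀ {g} → g ∈ elems G → ∀ u v → Δ (app g u) (app g v) ≡ Δ u v)
  (transitive : VertexTransitive G) where

  arc-image : ∀ {g} → g ∈ elems G → ∀ {u v} → T (Δ u v) → T (Δ (app g u) (app g v))
  arc-image g∈G {u} {v} uv = subst T (sym (Δ-invariant g∈G u v)) uv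

  iterate : Perm n → ℕ → Fin n → Fin n
  iterate g zero    u = u
  iterate g (suc k) u = app g (iterate g k u)

  -- Some positive power of a permutation fixes u (pigeonhole on u, g u, …, gⁿ u).
  power-fixes : ∀ g → IsPerm g → ∀ u → ∃ λ k → iterate g (suc k) u ≡ u
  power-fixes g g-inj u
    with i , j , i<j , gⁱu≡gʲu ← FinP.pigeonhole (n<1+n n) (λ i → iterate g (toℕ i) u)
    with k , 1+i+k≡j ← m≤n⇒∃[o]m+o≡n i<j =
    k , sym (cancel (toℕ i) (trans gⁱu≡gʲu (cong (λ m → iterate g m u) (trans (sym 1+i+k≡j) (sym (+-suc (toℕ i) k))))))
    where
    cancel : ∀ i {m} → iterate g i u ≡ iterate g (i + m) u → u ≡ iterate g m u
    cancel zero    gⁱu≡gⁱ⁺ᵐu = gⁱu≡gⁱ⁺ᵐu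
    cancel (suc i) gⁱu≡gⁱ⁺ᵐu = cancel i (g-inj _ _ gⁱu≡gⁱ⁺ᵐu)

  power-walk : ∀ {g} → g ∈ elems G → ∀ {u} → T (Δ u (app g u)) → ∀ k → Reachable Δ (app g u) (iterate g (suc k) u)
  power-walk {g} g∈G {u} u→gu = walk
    where
    arc : ∀ k → T (Δ (iterate g k u) (iterate g (suc k) u))
    arc zero    = u→gu
    arc (suc k) = arc-image g∈G (arc k)
    walk : ∀ k → Reachable Δ (app g u) (iterate g (suc k) u)
    walk zero    = here
    walk (suc k) = walk k ◅◅ step (arc (suc k)) here

  arc-reverse : ∀ {u v} → T (Δ u v) → Reachable Δ v u
  arc-reverse {u} {v} uv with g , g∈G , gu≡v ← transitive u v with k , gᵏ⁺¹u≡u ← power-fixes g (perms G g∈G) u =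
    subst₂ (Reachable Δ) gu≡v gᵏ⁺¹u≡u (power-walk g∈G (subst (λ w → T (Δ u w)) (sym gu≡v) uv) k)

  strongly-connected : Connected (sym𝔹 Δ) → Connected Δ
  strongly-connected weakly u v = directed (weakly u v)
    where
    directed : ∀ {u v} → Reachable (sym𝔹 Δ) u v → Reachable Δ u v
    directed here = here
    directed (step uw walk) with Equivalence.to T-∨ uw
    ... | inj₁ u→w = step u→w (directed walk)
    ... | inj₂ w→u = arc-reverse w→u ◅◅ directed walk

toList-tabulate : ∀ {A : Set} {m} (f : Fin m → A) → Vec.toList (Vec.tabulate f) ≡ List.tabulate f
toList-tabulate {m = zero}  f = refl
toList-tabulate {m = suc m} f = cong (f Data.Fin.zero ∷_) (toList-tabulate (f ∘ Data.Fin.suc))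

vertices : ∀ n → List (Fin n)
vertices n = Vec.toList (allFin n)

∈vertices : ∀ {n} (x : Fin n) → x ∈ vertices n
∈vertices {n} x = subst (x ∈_) (sym (toList-tabulate id)) (∈-allFin x)

vertices-unique : ∀ n → Unique (vertices n)
vertices-unique n = subst Unique (sym (toList-tabulate id)) (allFin⁺ n)

module _ {n} (R : Rel𝔹 n) {u : Fin n} where

  ∈nbhd⁻ : ∀ {x} → x ∈ nbhd R u → T (R u x)
  ∈nbhd⁻ x∈ = proj₂ (∈-filter⁻ (λ x → T? (R u x)) {xs = vertices n} x∈)

  ∈nbhd⁺ : ∀ {x} → T (R u x) → x ∈ nbhd R u
  ∈nbhd⁺ {x} ux = ∈-filter⁺ (λ x → T? (R u x)) (∈vertices x) ux

  nbhd-unique : Unique (nbhd R u)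
  nbhd-unique = filter⁺ (λ x → T? (R u x)) (vertices-unique n)

map-fixed⇒fixes : ∀ {A : Set} {f : A → A} ρ → map f ρ ≡ ρ → All (λ x → f x ≡ x) ρ
map-fixed⇒fixes []      _        = []
map-fixed⇒fixes (x ∷ ρ) fxfρ≡xρ = ListP.∷-injectiveˡ fxfρ≡xρ ∷ map-fixed⇒fixes ρ (ListP.∷-injectiveʳ fxfρ≡xρ)

-- The pointwise stabiliser N_S of a list S of vertices, built so that
-- N_{x ∷ S} = (N_S)_x; thus N_[α] and N_[β,α] are the lists counted by
-- ordStab N α and ordStab2 N α β.
module PointwiseStabiliser {n} (N : PermGroup n) where

  pointStab : List (Fin n) → List (Perm n)
  pointStab []      = elems N
  pointStab (x ∷ S) = stabList (pointStab S) x

  Fixes : Perm n → List (Fin n) → Set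
  Fixes g S = All (λ x → app g x ≡ x) S

  ∈pointStab⁻ : ∀ S {g} → g ∈ pointStab S → g ∈ elems N × Fixes g S
  ∈pointStab⁻ []      g∈ = g∈ , []
  ∈pointStab⁻ (x ∷ S) g∈ with g∈N_S , gx≡x ← ∈-filter⁻ (λ g → T? ⌊ app g x ≟F x ⌋) {xs = pointStab S} g∈
    with g∈N , fixes-S ← ∈pointStab⁻ S g∈N_S = g∈N , toWitness gx≡x ∷ fixes-S

  ∈pointStab⁺ : ∀ S {g} → g ∈ elems N → Fixes g S → g ∈ pointStab S
  ∈pointStab⁺ []      g∈N _                = g∈N
  ∈pointStab⁺ (x ∷ S) g∈N (gx≡x ∷ fixes-S) =
    ∈-filter⁺ (λ g → T? ⌊ app g x ≟F x ⌋) (∈pointStab⁺ S g∈N fixes-S) (fromWitness gx≡x)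

  pointStab-unique : ∀ S → Unique (pointStab S)
  pointStab-unique []      = unique N
  pointStab-unique (x ∷ S) = filter⁺ (λ g → T? ⌊ app g x ≟F x ⌋) (pointStab-unique S)

  PointStab : List (Fin n) → PermGroup n
  PointStab S = record
    { elems  = pointStab S
    ; unique = pointStab-unique S
    ; perms  = λ g∈ → perms N (proj₁ (∈pointStab⁻ S g∈))
    ; hasId  = ∈pointStab⁺ S (hasId N) (All.tabulate λ {x} _ → app-id x)
    ; closed = λ {g} {h} g∈ h∈ →
        let (g∈N , g-fixes) = ∈pointStab⁻ S g∈ ; (h∈N , h-fixes) = ∈pointStab⁻ S h∈ in
        ∈pointStab⁺ S (closed N g∈N h∈N) (All.tabulate λ {x} x∈S →
          trans (app-∘ g h x) (trans (cong (app g) (All.lookup h-fixes x∈S)) (All.lookup g-fixes x∈S)))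
    }

  pointStab-⊆ : ∀ {S γ} → γ ∈ S → pointStab S ⊆ pointStab (γ ∷ [])
  pointStab-⊆ {S} γ∈S g∈ with g∈N , g-fixes ← ∈pointStab⁻ S g∈ = ∈pointStab⁺ (_ ∷ []) g∈N (All.lookup g-fixes γ∈S ∷ [])

  pointStab-all : ∀ S → (∀ v → v ∈ S) → length (pointStab S) ≡ 1
  pointStab-all S covers = ≤-antisym (⊆⇒length≤ (pointStab-unique S) only-id) (∈-length (hasId (PointStab S)))
    where
    open Counting _≟P_ using (⊆⇒length≤)
    only-id : pointStab S ⊆ (idP ∷ [])
    only-id g∈ = here (perm-ext λ i → trans (All.lookup (proj₂ (∈pointStab⁻ S g∈)) (covers i)) (sym (app-id i)))

module Setting {n} (G N : PermGroup n) (Δ : Rel𝔹 n) (N⊴G : N ⊴ G)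
  (Δ-invariant : ∀ {g} → g ∈ elems G → ∀ u v → Δ (app g u) (app g v) ≡ Δ u v)
  (transitive : VertexTransitive G) (weakly-connected : Connected (sym𝔹 Δ)) where

  open StrongConnectivity G Δ Δ-invariant transitive
  open PointwiseStabiliser N
  private module CountVertices = Counting (_≟F_ {n})
  private module CountPerms = Counting (_≟P_ {n})

  Δ-connected : Connected Δ
  Δ-connected = strongly-connected weakly-connected

  N⊆G : ∀ {h} → h ∈ elems N → h ∈ elems G
  N⊆G = proj₁ N⊴G

  stab-preserves-nbhd : ∀ {γ a x} → a ∈ pointStab (γ ∷ []) → x ∈ nbhd Δ γ → app a x ∈ nbhd Δ γ
  stab-preserves-nbhd {γ} a∈ x∈ with a∈N , (aγ≡γ ∷ []) ← ∈pointStab⁻ (γ ∷ []) a∈ =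
    ∈nbhd⁺ Δ (subst (λ w → T (Δ w _)) aγ≡γ (arc-image (N⊆G a∈N) (∈nbhd⁻ Δ x∈)))

  mapP : Perm n → List (Fin n) → List (Fin n)
  mapP g = map (app g)

  mapP-∘ : ∀ g h ρ → mapP (g ∘P h) ρ ≡ mapP g (mapP h ρ)
  mapP-∘ g h ρ = trans (ListP.map-cong (app-∘ g h) ρ) (ListP.map-∘ ρ)

  mapP-id : ∀ ρ → mapP idP ρ ≡ ρ
  mapP-id ρ = trans (ListP.map-cong app-id ρ) (ListP.map-id ρ)

  module OnVertices S = Action _≟F_ app app-∘ app-id (PointStab S)
  module OnLists S = Action (ListP.≡-dec _≟F_) mapP mapP-∘ mapP-id (PointStab S)

  ∈listStab⁻ : ∀ S ρ {a} → a ∈ OnLists.stab S ρ → a ∈ pointStab S × Fixes a ρ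
  ∈listStab⁻ S ρ a∈ with a∈N_S , aρ≡ρ ← OnLists.∈stab⁻ S a∈ = a∈N_S , map-fixed⇒fixes ρ aρ≡ρ

  ∈listStab⁺ : ∀ S ρ {a} → a ∈ pointStab S → Fixes a ρ → a ∈ OnLists.stab S ρ
  ∈listStab⁺ S ρ a∈N_S a-fixes = OnLists.∈stab⁺ S a∈N_S (ListP.map-id-local a-fixes)

  -- |N_γ^{Δ(γ)}| is the length of the N_γ-orbit of the list Δ(γ); this is
  -- literally ordInduced N Δ γ.  Its stabiliser is the kernel N_γ^{[1]}.
  localOrder : Fin n → ℕ
  localOrder γ = length (OnLists.orbit (γ ∷ []) (nbhd Δ γ))

  kernel : Fin n → List (Perm n)
  kernel γ = OnLists.stab (γ ∷ []) (nbhd Δ γ)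

  module Conjugation {g} (g∈G : g ∈ elems G) {u v} (gu≡v : app g u ≡ v) where
    open Inverse (inverse G g∈G)

    g⁻¹v≡u : app g⁻¹ v ≡ u
    g⁻¹v≡u = trans (cong (app g⁻¹) (sym gu≡v)) (app-invˡ u)

    conj : Perm n → Perm n
    conj h = g ∘P (h ∘P g⁻¹)

    app-conj : ∀ h x → app (conj h) x ≡ app g (app h (app g⁻¹ x))
    app-conj h x = trans (app-∘ g (h ∘P g⁻¹) x) (cong (app g) (app-∘ h g⁻¹ x))

    conj-∈N : ∀ {h} → h ∈ elems N → conj h ∈ elems N
    conj-∈N {h} h∈N with h′ , h′∈N , gh≡h′g ← proj₂ N⊴G g∈G h∈N = subst (_∈ elems N) (sym conj≡h′) h′∈N
      where
      open ≡-Reasoning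
      conj≡h′ : conj h ≡ h′
      conj≡h′ = begin
        g ∘P (h ∘P g⁻¹)   ≡⟨ ∘-assoc g h g⁻¹ ⟨
        (g ∘P h) ∘P g⁻¹   ≡⟨ cong (_∘P g⁻¹) gh≡h′g ⟩
        (h′ ∘P g) ∘P g⁻¹  ≡⟨ ∘-assoc h′ g g⁻¹ ⟩
        h′ ∘P (g ∘P g⁻¹)  ≡⟨ cong (h′ ∘P_) invʳ ⟩
        h′ ∘P idP         ≡⟨ ∘-identityʳ h′ ⟩
        h′                ∎

    conj-injective : ∀ {h h′} → conj h ≡ conj h′ → h ≡ h′
    conj-injective {h} {h′} conj≡ = perm-ext λ x → begin
      app h x                     ≡⟨ cong (app h) (app-invˡ x) ⟨
      app h (app g⁻¹ (app g x))   ≡⟨ perms G g∈G _ _ (trans (sym (app-conj h (app g x))) (trans (cong (λ k → app k (app g x)) conj≡) (app-conj h′ (app g x)))) ⟩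
      app h′ (app g⁻¹ (app g x))  ≡⟨ cong (app h′) (app-invˡ x) ⟩
      app h′ x                    ∎
      where open ≡-Reasoning

    conj-fixes-v : ∀ {h} → app h u ≡ u → app (conj h) v ≡ v
    conj-fixes-v {h} hu≡u = trans (app-conj h v) (trans (cong (λ w → app g (app h w)) g⁻¹v≡u) (trans (cong (app g) hu≡u) gu≡v))

    conj-stab : ∀ {h} → h ∈ pointStab (u ∷ []) → conj h ∈ pointStab (v ∷ [])
    conj-stab {h} h∈ with h∈N , (hu≡u ∷ []) ← ∈pointStab⁻ (u ∷ []) h∈ =
      ∈pointStab⁺ (v ∷ []) (conj-∈N h∈N) (conj-fixes-v {h} hu≡u ∷ [])

    nbhd-image : ∀ {x} → x ∈ nbhd Δ u → app g x ∈ nbhd Δ v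
    nbhd-image x∈ = ∈nbhd⁺ Δ (subst (λ w → T (Δ w _)) gu≡v (arc-image g∈G (∈nbhd⁻ Δ x∈)))

    nbhd-preimage : ∀ {x} → x ∈ nbhd Δ v → app g⁻¹ x ∈ nbhd Δ u
    nbhd-preimage x∈ = ∈nbhd⁺ Δ (subst (λ w → T (Δ w _)) g⁻¹v≡u (arc-image g⁻¹∈H (∈nbhd⁻ Δ x∈)))

    conj-kernel : ∀ {h} → h ∈ kernel u → conj h ∈ kernel v
    conj-kernel {h} h∈ with h∈N_u , h-fixes ← ∈listStab⁻ (u ∷ []) (nbhd Δ u) h∈ =
      ∈listStab⁺ (v ∷ []) (nbhd Δ v) (conj-stab {h} h∈N_u) (All.tabulate λ {x} x∈ →
        trans (app-conj h x) (trans (cong (app g) (All.lookup h-fixes (nbhd-preimage x∈))) (app-invʳ x)))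

    degree≤ : deg Δ u ≤ deg Δ v
    degree≤ = CountVertices.injection⇒length≤ (perms G g∈G _ _) (nbhd-unique Δ) nbhd-image

    stab-length≤ : length (pointStab (u ∷ [])) ≤ length (pointStab (v ∷ []))
    stab-length≤ = CountPerms.injection⇒length≤ conj-injective (pointStab-unique (u ∷ [])) conj-stab

    kernel-length≤ : length (kernel u) ≤ length (kernel v)
    kernel-length≤ = CountPerms.injection⇒length≤ conj-injective (OnLists.stab-unique (u ∷ []) (nbhd Δ u)) conj-kernel

  degree-constant : ∀ u v → deg Δ u ≡ deg Δ v
  degree-constant u v with g , g∈G , gu≡v ← transitive u v with g′ , g′∈G , g′v≡u ← transitive v u =
    ≤-antisym (Conjugation.degree≤ g∈G gu≡v) (Conjugation.degree≤ g′∈G g′v≡u)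

  localOrder-constant : ∀ u v → localOrder u ≡ localOrder v
  localOrder-constant u v with g , g∈G , gu≡v ← transitive u v with g′ , g′∈G , g′v≡u ← transitive v u =
    *-cancelʳ-≡ (localOrder u) (localOrder v) (length (kernel u)) {{>-nonZero (∈-length (OnLists.idP∈stab (u ∷ []) (nbhd Δ u)))}} (begin
      localOrder u * length (kernel u)  ≡⟨ OnLists.orbit-stabiliser (u ∷ []) (nbhd Δ u) ⟨
      length (pointStab (u ∷ []))       ≡⟨ ≤-antisym (Conjugation.stab-length≤ g∈G gu≡v) (Conjugation.stab-length≤ g′∈G g′v≡u) ⟩
      length (pointStab (v ∷ []))       ≡⟨ OnLists.orbit-stabiliser (v ∷ []) (nbhd Δ v) ⟩
      localOrder v * length (kernel v)  ≡⟨ cong (localOrder v *_) (≤-antisym (Conjugation.kernel-length≤ g′∈G g′v≡u) (Conjugation.kernel-length≤ g∈G gu≡v)) ⟩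
      localOrder v * length (kernel u)  ∎)
    where open ≡-Reasoning

  listStab-length : ∀ S ρ → length (OnLists.stab S ρ) ≡ length (pointStab (ρ ++ S))
  listStab-length S ρ = CountPerms.⊆⊇⇒length≡ (OnLists.stab-unique S ρ) (pointStab-unique (ρ ++ S)) stab⊆ stab⊇
    where
    stab⊆ : OnLists.stab S ρ ⊆ pointStab (ρ ++ S)
    stab⊆ a∈ with a∈N_S , fixes-ρ ← ∈listStab⁻ S ρ a∈ with a∈N , fixes-S ← ∈pointStab⁻ S a∈N_S =
      ∈pointStab⁺ (ρ ++ S) a∈N (AllP.++⁺ fixes-ρ fixes-S)
    stab⊇ : pointStab (ρ ++ S) ⊆ OnLists.stab S ρ
    stab⊇ a∈ with a∈N , fixes ← ∈pointStab⁻ (ρ ++ S) a∈ =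
      ∈listStab⁺ S ρ (∈pointStab⁺ S a∈N (AllP.++⁻ʳ ρ fixes)) (AllP.++⁻ˡ ρ fixes)

  -- Lists with the same entries have the same stabiliser in N_S, hence
  -- N_S-orbits of the same length.
  orbit-length-cong : ∀ S {ρ σ} → ρ ⊆ σ → σ ⊆ ρ → length (OnLists.orbit S ρ) ≡ length (OnLists.orbit S σ)
  orbit-length-cong S {ρ} {σ} ρ⊆σ σ⊆ρ =
    *-cancelʳ-≡ _ _ (length (OnLists.stab S σ)) {{>-nonZero (∈-length (OnLists.idP∈stab S σ))}} (begin
      length (OnLists.orbit S ρ) * length (OnLists.stab S σ)  ≡⟨ cong (length (OnLists.orbit S ρ) *_) same-stab ⟨
      length (OnLists.orbit S ρ) * length (OnLists.stab S ρ)  ≡⟨ OnLists.orbit-stabiliser S ρ ⟨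
      length (pointStab S)                                    ≡⟨ OnLists.orbit-stabiliser S σ ⟩
      length (OnLists.orbit S σ) * length (OnLists.stab S σ)  ∎)
    where
    open ≡-Reasoning
    restrict : ∀ {τ τ′} → τ′ ⊆ τ → OnLists.stab S τ ⊆ OnLists.stab S τ′
    restrict {τ} {τ′} τ′⊆τ a∈ with a∈N_S , fixes ← ∈listStab⁻ S τ a∈ =
      ∈listStab⁺ S τ′ a∈N_S (All.tabulate (All.lookup fixes ∘ τ′⊆τ))
    same-stab : length (OnLists.stab S ρ) ≡ length (OnLists.stab S σ)
    same-stab = CountPerms.⊆⊇⇒length≡ (OnLists.stab-unique S ρ) (OnLists.stab-unique S σ) (restrict σ⊆ρ) (restrict ρ⊆σ)

  -- For γ ∈ S the N_S-orbit of the list Δ(γ) has length dividing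
  -- |N_γ^{Δ(γ)}|: as N_S ≤ N_γ, the N_γ-orbit of Δ(γ) is a union of
  -- N_S-orbits, and all of them have the same length because their points
  -- are reorderings of Δ(γ).
  suborbit∣localOrder : ∀ {S γ} → γ ∈ S → length (OnLists.orbit S (nbhd Δ γ)) ∣ localOrder γ
  suborbit∣localOrder {S} {γ} γ∈S =
    OnLists.equal-orbits⇒∣ S _ Xs (OnLists.orbit-unique (γ ∷ []) (nbhd Δ γ)) invariant same-length
    where
    Xs = OnLists.orbit (γ ∷ []) (nbhd Δ γ)
    invariant : ∀ {a ρ} → a ∈ pointStab S → ρ ∈ Xs → mapP a ρ ∈ Xs
    invariant {a} a∈ ρ∈ with b , b∈ , refl ← OnLists.∈orbit⁻ (γ ∷ []) ρ∈ =
      subst (_∈ Xs) (mapP-∘ a b (nbhd Δ γ)) (OnLists.∈orbit⁺ (γ ∷ []) (closed (PointStab (γ ∷ [])) (pointStab-⊆ γ∈S a∈) b∈))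
    same-length : ∀ {ρ} → ρ ∈ Xs → length (OnLists.orbit S ρ) ≡ length (OnLists.orbit S (nbhd Δ γ))
    same-length ρ∈ with b , b∈ , refl ← OnLists.∈orbit⁻ (γ ∷ []) ρ∈ = orbit-length-cong S image⊆ ⊆image
      where
      open Inverse (inverse (PointStab (γ ∷ [])) b∈)
      image⊆ : mapP b (nbhd Δ γ) ⊆ nbhd Δ γ
      image⊆ y∈ with x , x∈ , refl ← ∈-map⁻ (app b) y∈ = stab-preserves-nbhd b∈ x∈
      ⊆image : nbhd Δ γ ⊆ mapP b (nbhd Δ γ)
      ⊆image {y} y∈ = subst (_∈ mapP b (nbhd Δ γ)) (app-invʳ y) (∈-map⁺ (app b) (stab-preserves-nbhd g⁻¹∈H y∈))

  point-orbit⊆nbhd : ∀ {S γ δ} → γ ∈ S → T (Δ γ δ) → OnVertices.orbit S δ ⊆ nbhd Δ γ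
  point-orbit⊆nbhd {S} γ∈S γδ y∈ with a , a∈ , refl ← OnVertices.∈orbit⁻ S y∈ =
    stab-preserves-nbhd (pointStab-⊆ γ∈S a∈) (∈nbhd⁺ Δ γδ)

  point-orbit-avoids : ∀ {S δ μ} → δ ∉ S → μ ∈ S → μ ∉ OnVertices.orbit S δ
  point-orbit-avoids {S} {δ} {μ} δ∉S μ∈S μ∈orbit with a , a∈ , μ≡aδ ← OnVertices.∈orbit⁻ S μ∈orbit =
    δ∉S (subst (_∈ S) (sym δ≡μ) μ∈S)
    where
    δ≡μ : δ ≡ μ
    δ≡μ = perms (PointStab S) a∈ δ μ (trans (sym μ≡aδ) (sym (All.lookup (proj₂ (∈pointStab⁻ S a∈)) μ∈S)))

  -- Enlarging S to S′ ⊇ S ∪ {δ} splits |N_S| = index · |N_S′|;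
  -- a prime dividing |N_S| divides the index (and then gives the conclusion C)
  -- or |N_S′|.  Since N_V = 1, the second case cannot persist.
  record Enlargement (p : ℕ) (C : Set) (Inv : List (Fin n) → Set) (S : List (Fin n)) (δ : Fin n) : Set where
    field
      S′           : List (Fin n)
      S′-inv       : Inv S′
      S⊆S′         : S ⊆ S′
      δ∈S′         : δ ∈ S′
      index        : ℕ
      index-factor : length (pointStab S) ≡ index * length (pointStab S′)
      prime-index  : p ∣ index → C

  -- the number of vertices outside S, the measure of the descent
  outside : List (Fin n) → ℕ
  outside S = length (filter (∁? (_∈? S)) (vertices n))
    where open import Data.List.Membership.DecPropositional (_≟F_ {n}) using (_∈?_)

  outside-decreases : ∀ {S S′ δ} → S ⊆ S′ → δ ∈ S′ → δ ∉ S → outside S′ < outside S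
  outside-decreases {S} {S′} {δ} S⊆S′ δ∈S′ δ∉S =
    CountVertices.⊆-missing⇒length< (filter⁺ (∁? (_∈? S′)) (vertices-unique n)) shrinks
      (∈-filter⁺ (∁? (_∈? S)) (∈vertices δ) δ∉S) (λ δ∈ → proj₂ (∈-filter⁻ (∁? (_∈? S′)) {xs = vertices n} δ∈) δ∈S′)
    where
    open import Data.List.Membership.DecPropositional (_≟F_ {n}) using (_∈?_)
    shrinks : filter (∁? (_∈? S′)) (vertices n) ⊆ filter (∁? (_∈? S)) (vertices n)
    shrinks x∈ with x∈V , x∉S′ ← ∈-filter⁻ (∁? (_∈? S′)) {xs = vertices n} x∈ = ∈-filter⁺ (∁? (_∈? S)) x∈V (x∉S′ ∘ S⊆S′)

  module Descent (p : ℕ) (p-prime : Prime p) (C : Set) (Inv : List (Fin n) → Set)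
    (enlarge : ∀ S → Inv S → ∀ {γ δ} → γ ∈ S → δ ∉ S → T (Δ γ δ) → Enlargement p C Inv S δ) where
    open import Data.List.Membership.DecPropositional (_≟F_ {n}) using (_∈?_)

    open Enlargement

    descent : ∀ S {x} → Inv S → x ∈ S → p ∣ length (pointStab S) → C
    descent S = go S (<-wellFounded (outside S))
      where
      go : ∀ S → Acc _<_ (outside S) → ∀ {x} → Inv S → x ∈ S → p ∣ length (pointStab S) → C
      go S (acc smaller) {x} S-inv x∈S p∣N_S with All.all? (_∈? S) (vertices n)
      ... | yes all∈S = ⊥-elim (¬prime[1] (subst Prime p≡1 p-prime))
        where
        p≡1 : p ≡ 1
        p≡1 = ∣1⇒≡1 (subst (p ∣_) (pointStab-all S (All.lookup all∈S ∘ ∈vertices)) p∣N_S)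
      ... | no ¬all∈S
        with v , v∉S ← Any.satisfied (¬All⇒Any¬ (_∈? S) (vertices n) ¬all∈S)
        with γ , δ , γ∈S , δ∉S , γδ ← leaving-arc S (Δ-connected x v) x∈S v∉S
        with E ← enlarge S S-inv γ∈S δ∉S γδ
        with euclidsLemma (index E) (length (pointStab (S′ E))) p-prime (subst (p ∣_) (index-factor E) p∣N_S)
      ... | inj₁ p∣index = prime-index E p∣index
      ... | inj₂ p∣N_S′  = go (S′ E) (smaller (outside-decreases (S⊆S′ E) (δ∈S′ E) δ∉S)) (S′-inv E) (S⊆S′ E x∈S) p∣N_S′

  ∣-nonempty⇒≤ : ∀ {A : Set} {p x} {xs : List A} → x ∈ xs → p ∣ length xs → p ≤ length xs
  ∣-nonempty⇒≤ x∈xs p∣ = ∣⇒≤ {{>-nonZero (∈-length x∈xs)}} p∣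

  -- Enlarging S by a single vertex δ: the index is |δ^{N_S}|, since (N_S)_δ = N_{δ ∷ S}.
  add-vertex : ∀ {p C Inv S δ} → Inv (δ ∷ S) → (p ∣ length (OnVertices.orbit S δ) → C) → Enlargement p C Inv S δ
  add-vertex {S = S} {δ} inv bound = record
    { S′ = δ ∷ S ; S′-inv = inv ; S⊆S′ = there ; δ∈S′ = here refl
    ; index = length (OnVertices.orbit S δ) ; index-factor = OnVertices.orbit-stabiliser S δ
    ; prime-index = bound }

  -- Claim 1: π(N_α) = π(N_α^{Δ(α)}).  One inclusion is orbit–stabiliser on
  -- N_α; for the other, enlarge S by a whole neighbourhood Δ(γ), whose index
  -- divides |N_γ^{Δ(γ)}| = |N_α^{Δ(α)}|.
  localOrder∣stab : ∀ α {p} → p ∣ localOrder α → p ∣ length (pointStab (α ∷ []))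
  localOrder∣stab α p∣ = subst (_ ∣_) (sym (OnLists.orbit-stabiliser (α ∷ []) (nbhd Δ α))) (∣m⇒∣m*n _ p∣)

  stab∣localOrder : ∀ α {p} → Prime p → p ∣ length (pointStab (α ∷ [])) → p ∣ localOrder α
  stab∣localOrder α {p} p-prime = Descent.descent p p-prime (p ∣ localOrder α) (λ _ → ⊤) add-nbhd (α ∷ []) tt (here refl)
    where
    add-nbhd : ∀ S → ⊤ → ∀ {γ δ} → γ ∈ S → δ ∉ S → T (Δ γ δ) → Enlargement p (p ∣ localOrder α) (λ _ → ⊤) S δ
    add-nbhd S _ {γ} γ∈S _ γδ = record
      { S′ = nbhd Δ γ ++ S ; S′-inv = tt ; S⊆S′ = ∈-++⁺ʳ (nbhd Δ γ) ; δ∈S′ = ∈-++⁺ˡ (∈nbhd⁺ Δ γδ)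
      ; index = length (OnLists.orbit S (nbhd Δ γ))
      ; index-factor = trans (OnLists.orbit-stabiliser S (nbhd Δ γ)) (cong (length (OnLists.orbit S (nbhd Δ γ)) *_) (listStab-length S (nbhd Δ γ)))
      ; prime-index = λ p∣ → subst (p ∣_) (localOrder-constant γ α) (∣-trans p∣ (suborbit∣localOrder γ∈S)) }

  -- Claim 2: every prime divisor of |N_α| is at most |Δ(α)|, since the
  -- orbit of δ ∈ Δ(γ) under N_S lies in Δ(γ).
  stab-prime≤degree : ∀ α {p} → Prime p → p ∣ length (pointStab (α ∷ [])) → p ≤ deg Δ α
  stab-prime≤degree α {p} p-prime = Descent.descent p p-prime (p ≤ deg Δ α) (λ _ → ⊤) add-δ (α ∷ []) tt (here refl)
    where
    add-δ : ∀ S → ⊤ → ∀ {γ δ} → γ ∈ S → δ ∉ S → T (Δ γ δ) → Enlargement p (p ≤ deg Δ α) (λ _ → ⊤) S δ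
    add-δ S _ {γ} {δ} γ∈S _ γδ = add-vertex tt λ p∣ → begin
      p                                  ≤⟨ ∣-nonempty⇒≤ (OnVertices.x∈orbit S δ) p∣ ⟩
      length (OnVertices.orbit S δ)      ≤⟨ CountVertices.⊆⇒length≤ (OnVertices.orbit-unique S δ) (point-orbit⊆nbhd γ∈S γδ) ⟩
      deg Δ γ                            ≡⟨ degree-constant γ α ⟩
      deg Δ α                            ∎
      where open ≤-Reasoning

  -- Keep every vertex of S with an out-neighbour in S (true for {α, β} and
  -- preserved by adding δ, as δ → γ); the out-neighbour μ ∈ S of γ is fixed
  -- by N_S, so the orbit of δ lies in Δ(γ) ∖ {μ}.
  HasNeighbourIn : List (Fin n) → Set
  HasNeighbourIn S = ∀ {x} → x ∈ S → ∃ λ y → y ∈ S × T (Δ x y)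

  twoStab-prime<degree : (∀ u v → Δ u v ≡ conv Δ u v) → ∀ {α β} → T (Δ α β) →
                         ∀ {p} → Prime p → p ∣ length (pointStab (β ∷ α ∷ [])) → p < deg Δ α
  twoStab-prime<degree Δ≡Δ* {α} {β} αβ {p} p-prime =
    Descent.descent p p-prime (p < deg Δ α) HasNeighbourIn add-δ (β ∷ α ∷ []) αβ-inv (there (here refl))
    where
    reverse : ∀ {u v} → T (Δ u v) → T (Δ v u)
    reverse {u} {v} uv = subst T (Δ≡Δ* u v) uv
    αβ-inv : HasNeighbourIn (β ∷ α ∷ [])
    αβ-inv (here refl)         = α , there (here refl) , reverse αβ
    αβ-inv (there (here refl)) = β , here refl , αβ
    add-δ : ∀ S → HasNeighbourIn S → ∀ {γ δ} → γ ∈ S → δ ∉ S → T (Δ γ δ) → Enlargement p (p < deg Δ α) HasNeighbourIn S δ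
    add-δ S S-inv {γ} {δ} γ∈S δ∉S γδ with μ , μ∈S , γμ ← S-inv γ∈S = add-vertex δ∷S-inv λ p∣ → begin-strict
      p                                  ≤⟨ ∣-nonempty⇒≤ (OnVertices.x∈orbit S δ) p∣ ⟩
      length (OnVertices.orbit S δ)      <⟨ CountVertices.⊆-missing⇒length< (OnVertices.orbit-unique S δ)
                                              (point-orbit⊆nbhd γ∈S γδ) (∈nbhd⁺ Δ γμ) (point-orbit-avoids δ∉S μ∈S) ⟩
      deg Δ γ                            ≡⟨ degree-constant γ α ⟩
      deg Δ α                            ∎
      where
      open ≤-Reasoning
      δ∷S-inv : HasNeighbourIn (δ ∷ S)
      δ∷S-inv (here refl) = γ , there γ∈S , reverse γδ
      δ∷S-inv (there x∈S) with y , y∈S , xy ← S-inv x∈S = y , there y∈S , xy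

lemma2p1 : (n : ℕ) (adj : Rel𝔹 n) (G N : PermGroup n) (Δ : Rel𝔹 n) →
    IsSimpleGraph adj → Connected adj → Regular adj →
    N ≤G G → AutGroup adj G → VertexTransitive G →
    N ⊴ G → Nontrivial N →
    UnionOfArcOrbits adj G Δ → Connected (sym𝔹 Δ) →
    (α β : Fin n) → T (Δ α β) →
    (SamePrimeDivisors (ordStab N α) (ordInduced N Δ α)
      × MaxPrimeDiv≤ (ordStab N α) (deg Δ α))
    × ((∀ (u v : Fin n) → Δ u v ≡ conv Δ u v) → MaxPrimeDiv< (ordStab2 N α β) (deg Δ α))
lemma2p1 n adj G N Δ _ _ _ _ _ transitive N⊴G _ (_ , Δ-invariant) weakly-connected α β αβ =
  ( (λ p p-prime → mk⇔ (stab∣localOrder α p-prime) (localOrder∣stab α))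
  , (λ p p-prime → stab-prime≤degree α p-prime) )
  , (λ Δ≡Δ* p p-prime → twoStab-prime<degree Δ≡Δ* αβ p-prime)
  where open Setting G N Δ N⊴G Δ-invariant transitive weakly-connected
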